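{- Let $\mathcal M$ be a regular linear hypermap on the sphere. Then $\mathcal M$ is either a medial linear hypermap or a digon linear hypermap.
   Context: For a finite group $G$ and pairwise distinct involutions $r_0,r_1,r_2$ generating $G$, $\mathcal M(G;r_0,r_1,r_2)$ is a regular linear hypermap if (1) $\langle r_1,r_2\rangle\cap\langle r_0,r_2\rangle=\langle r_2\rangle$ and (2) $\langle r_1,r_2\rangle\langle r_0,r_2\rangle\cap\langle r_0,r_2\rangle\langle r_1,r_2\rangle=\langle r_1,r_2\rangle\cup\langle r_0,r_2\rangle$; vertices, hyperedges, hyperfaces correspond to cosets of $\langle r_1,r_2\rangle,\langle r_0,r_2\rangle,\langle r_0,r_1\rangle$ with counts $V,E,F$; it is non-orientable if $G=\langle r_0r_2,r_1r_2\rangle$, otherwise orientable, with genus $g$ given by $V+E+F-|G|/2=2-2g$ (orientable) or $2-g$; it lies on the sphere when orientable of genus 0. For a map $M$ with simple underlying graph: the digon linear hypermap of $M$ replaces each edge of $M$ by a digon (two parallel edges bounding a 2-cell), with hyperedges the digons and hyperfaces the faces of $M$. Two edges of $M$ are contiguous if consecutive around a corner; the medial map $M^{\mathrm{med}}$ has the edges of $M$ as vertices, adjacent when contiguous. A linear hypermap is the medial linear hypermap of $M$ if its associated map (the embedded graph whose faces are hyperedges and hyperfaces) is $M^{\mathrm{med}}$ and its hyperedges and hyperfaces correspond naturally to the vertices and faces of $M$. A linear hypermap is medial (resp. digon) if it is the medial (resp. digon) linear hypermap of some map with simple underlying graph. -}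

module Defs where

open import Data.Nat using (ℕ; _+_; _*_)
open import Data.Fin using (Fin)
open import Data.List using (List; []; _∷_)
open import Data.List.Membership.Propositional using (_∈_)
open import Data.Product using (Σ; ∃; ∃₂; _×_; _,_)
open import Data.Sum using (_⊎_)
open import Relation.Binary.PropositionalEquality using (_≡_; _≢_)
open import Relation.Nullary using (¬_)
open import Function.Bundles using (_↔_; Inverse)
open import Algebra.Structures using (IsGroup)

record FinGroup : Set where
  infixl 7 _∙_
  field
    order   : ℕ
    _∙_     : Fin order → Fin order → Fin order
    ε       : Fin order
    _⁻¹     : Fin order → Fin order
    isGroup : IsGroup _≡_ _∙_ ε _⁻¹

module GroupNotions (G : FinGroup) where
  open FinGroup G

  Carrier : Set
  Carrier = Fin order

  data ⟨_⟩ (S : List Carrier) : Carrier → Set where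
    gen-ε   : ⟨ S ⟩ ε
    gen-mul : ∀ {s x} → s ∈ S → ⟨ S ⟩ x → ⟨ S ⟩ (s ∙ x)
    gen-inv : ∀ {s x} → s ∈ S → ⟨ S ⟩ x → ⟨ S ⟩ ((s ⁻¹) ∙ x)

  _·ₛ_ : (Carrier → Set) → (Carrier → Set) → Carrier → Set
  (A ·ₛ B) x = ∃₂ λ a b → A a × B b × x ≡ a ∙ b

  -- The subgroup H has exactly k left cosets gH in G.
  NumCosets : (Carrier → Set) → ℕ → Set
  NumCosets H k =
    Σ (Fin k → Carrier) λ rep →
      (∀ i j → i ≢ j → ¬ H ((rep i ⁻¹) ∙ rep j)) ×
      (∀ g → ∃ λ i → H ((rep i ⁻¹) ∙ g))

  IsInvolution : Carrier → Set
  IsInvolution r = r ≢ ε × r ∙ r ≡ ε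

record RegularLinearHypermap : Set where
  field
    G : FinGroup
  open FinGroup G public
  open GroupNotions G public
  field
    r0 r1 r2 : Carrier
    inv0 : IsInvolution r0
    inv1 : IsInvolution r1
    inv2 : IsInvolution r2
    r0≢r1 : r0 ≢ r1
    r0≢r2 : r0 ≢ r2
    r1≢r2 : r1 ≢ r2
    generates : ∀ g → ⟨ r0 ∷ r1 ∷ r2 ∷ [] ⟩ g
    linear₁ : ∀ x → (⟨ r1 ∷ r2 ∷ [] ⟩ x × ⟨ r0 ∷ r2 ∷ [] ⟩ x → ⟨ r2 ∷ [] ⟩ x)
                  × (⟨ r2 ∷ [] ⟩ x → ⟨ r1 ∷ r2 ∷ [] ⟩ x × ⟨ r0 ∷ r2 ∷ [] ⟩ x)
    linear₂ : ∀ x →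
      ((⟨ r1 ∷ r2 ∷ [] ⟩ ·ₛ ⟨ r0 ∷ r2 ∷ [] ⟩) x × (⟨ r0 ∷ r2 ∷ [] ⟩ ·ₛ ⟨ r1 ∷ r2 ∷ [] ⟩) x
         → ⟨ r1 ∷ r2 ∷ [] ⟩ x ⊎ ⟨ r0 ∷ r2 ∷ [] ⟩ x)
      × (⟨ r1 ∷ r2 ∷ [] ⟩ x ⊎ ⟨ r0 ∷ r2 ∷ [] ⟩ x
         → (⟨ r1 ∷ r2 ∷ [] ⟩ ·ₛ ⟨ r0 ∷ r2 ∷ [] ⟩) x × (⟨ r0 ∷ r2 ∷ [] ⟩ ·ₛ ⟨ r1 ∷ r2 ∷ [] ⟩) x)

module _ (M : RegularLinearHypermap) where
  open RegularLinearHypermap M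

  Orientable : Set
  Orientable = ∃ λ g → ¬ ⟨ (r0 ∙ r2) ∷ (r1 ∙ r2) ∷ [] ⟩ g

  -- on the sphere: orientable of genus 0, i.e. V + E + F - |G|/2 = 2
  OnSphere : Set
  OnSphere = Orientable ×
    Σ ℕ λ V → Σ ℕ λ E → Σ ℕ λ F →
      NumCosets ⟨ r1 ∷ r2 ∷ [] ⟩ V ×
      NumCosets ⟨ r0 ∷ r2 ∷ [] ⟩ E ×
      NumCosets ⟨ r0 ∷ r1 ∷ [] ⟩ F ×
      2 * (V + E + F) ≡ order + 4

-- Combinatorial (flag) description of hypermaps: a finite set of flags
-- with three involutions ρ0 ρ1 ρ2.  Vertices / hyperedges / hyperfaces are
-- the orbits of ⟨ρ1,ρ2⟩ / ⟨ρ0,ρ2⟩ / ⟨ρ0,ρ1⟩.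

record FlagSystem : Set where
  field
    size : ℕ
    ρ0 ρ1 ρ2 : Fin size → Fin size

_≅_ : FlagSystem → FlagSystem → Set
A ≅ B = Σ (Fin (FlagSystem.size A) ↔ Fin (FlagSystem.size B)) λ φ →
  let f = Inverse.to φ in
  (∀ x → f (FlagSystem.ρ0 A x) ≡ FlagSystem.ρ0 B (f x)) ×
  (∀ x → f (FlagSystem.ρ1 A x) ≡ FlagSystem.ρ1 B (f x)) ×
  (∀ x → f (FlagSystem.ρ2 A x) ≡ FlagSystem.ρ2 B (f x))

-- The flag system of M(G; r0, r1, r2): flags are elements of G,
-- ρi g = g ri, so vertices etc. are the left cosets g⟨r1,r2⟩ etc.
flagsOf : RegularLinearHypermap → FlagSystem
flagsOf M = record { size = order ; ρ0 = _∙ r0 ; ρ1 = _∙ r1 ; ρ2 = _∙ r2 }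
  where open RegularLinearHypermap M

data SameOrbit {m : ℕ} (fs : List (Fin m → Fin m)) : Fin m → Fin m → Set where
  orb-refl : ∀ {x} → SameOrbit fs x x
  orb-step : ∀ {f x y} → f ∈ fs → SameOrbit fs (f x) y → SameOrbit fs x y

-- Maps (on closed surfaces) in flag form, with simple underlying graph.
-- τ0 changes the vertex, τ1 the edge, τ2 the face of a flag.

record MapWithSimpleGraph : Set where
  field
    size : ℕ
    τ0 τ1 τ2 : Fin size → Fin size
    τ0-invol : ∀ x → τ0 (τ0 x) ≡ x
    τ1-invol : ∀ x → τ1 (τ1 x) ≡ x
    τ2-invol : ∀ x → τ2 (τ2 x) ≡ x
    τ0-fpf : ∀ x → τ0 x ≢ x
    τ1-fpf : ∀ x → τ1 x ≢ x
    τ2-fpf : ∀ x → τ2 x ≢ x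
    τ02-comm : ∀ x → τ0 (τ2 x) ≡ τ2 (τ0 x)
    τ02-fpf : ∀ x → τ0 (τ2 x) ≢ x
    connected : ∀ x y → SameOrbit (τ0 ∷ τ1 ∷ τ2 ∷ []) x y
  SameVertex : Fin size → Fin size → Set
  SameVertex = SameOrbit (τ1 ∷ τ2 ∷ [])
  SameEdge : Fin size → Fin size → Set
  SameEdge = SameOrbit (τ0 ∷ τ2 ∷ [])
  field
    noLoops : ∀ x → ¬ SameVertex x (τ0 x)
    noMultiEdges : ∀ x y → SameVertex x y → SameVertex (τ0 x) (τ0 y) → SameEdge x y

-- Digon linear hypermap of M: vertices, hyperedges (digons), hyperfaces
-- are the vertices, edges, faces of M.
digonHypermap : MapWithSimpleGraph → FlagSystem
digonHypermap M = record { size = size ; ρ0 = τ0 ; ρ1 = τ1 ; ρ2 = τ2 }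
  where open MapWithSimpleGraph M

-- Medial linear hypermap of M: vertices = edges of M (⟨τ0,τ2⟩),
-- hyperedges = vertices of M (⟨τ1,τ2⟩), hyperfaces = faces of M (⟨τ0,τ1⟩).
medialHypermap : MapWithSimpleGraph → FlagSystem
medialHypermap M = record { size = size ; ρ0 = τ1 ; ρ1 = τ0 ; ρ2 = τ2 }
  where open MapWithSimpleGraph M

IsDigon : FlagSystem → Set
IsDigon H = ∃ λ (M : MapWithSimpleGraph) → digonHypermap M ≅ H

IsMedial : FlagSystem → Set
IsMedial H = ∃ λ (M : MapWithSimpleGraph) → medialHypermap M ≅ H

{-# OPTIONS --safe #-}
module Submission where

-- If r0 commutes with r2, the right actions of r0, r1, r2 on G are the flag
-- involutions of a map whose digon hypermap is M; linearity (1) rules out loops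
-- and linearity (2) rules out multiple edges.  Exchanging r0 and r1 preserves
-- linearity and turns a commuting pair r1, r2 into the medial case.  If neither
-- pair commutes then, as (2) also forbids r0 r1 = r1 r0, the three dihedral
-- groups ⟨r1,r2⟩, ⟨r0,r2⟩, ⟨r0,r1⟩ are non-abelian, hence of order at least 6.
-- So V, E, F ≤ |G|/6 and V + E + F ≤ |G|/2, against V + E + F = |G|/2 + 2.

open import Defs
open import Level using (0ℓ)
open import Algebra.Bundles using (Group)
open import Algebra.Structures using (IsGroup)
import Algebra.Properties.Group as GroupProperties
open import Data.Empty using (⊥-elim)
open import Data.Nat using (_+_; _*_; _≤_)
open import Data.Nat.Properties using (+-mono-≤; m+1+n≰m; module ≤-Reasoning)
open import Data.Nat.Tactic.RingSolver using (solve-∀)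
open import Data.Fin using (Fin; remQuot)
open import Data.Fin.Properties using (injective⇒≤; *↔×) renaming (_≟_ to _≟ᶠ_)
open import Data.List using (List; []; _∷_; map)
open import Data.List.Membership.Propositional using (_∈_)
open import Data.List.Membership.Propositional.Properties using (∈-map⁺; ∈-map⁻)
open import Data.List.Relation.Unary.Any using (here; there)
open import Data.List.Relation.Unary.All as All using (All; []; _∷_)
open import Data.List.Relation.Binary.Subset.Propositional using (_⊆_)
open import Data.Vec as Vec using (Vec; []; _∷_)
open import Data.Vec.Relation.Unary.All as VecAll using ([]; _∷_)
open import Data.Vec.Relation.Unary.AllPairs using ([]; _∷_)
open import Data.Vec.Relation.Unary.All.Properties using (lookup⁺)
open import Data.Vec.Relation.Unary.Unique.Propositional using (Unique)
open import Data.Vec.Relation.Unary.Unique.Propositional.Properties using (lookup-injective)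
open import Data.Product as Product using (_×_; _,_; proj₁; proj₂)
open import Data.Sum as Sum using (_⊎_; inj₁; inj₂)
open import Function using (_∘_)
open import Function.Bundles using (Injection)
open import Function.Properties.Inverse using (↔⇒↣)
open import Function.Construct.Identity using (↔-id)
open import Relation.Nullary using (¬_; yes; no)
open import Relation.Binary.PropositionalEquality

module FinGroupProperties (G : FinGroup) where
  open FinGroup G
  open GroupNotions G

  group : Group 0ℓ 0ℓ
  group = record
    { Carrier = Carrier ; _≈_ = _≡_ ; _∙_ = _∙_ ; ε = ε ; _⁻¹ = _⁻¹ ; isGroup = isGroup }

  open IsGroup isGroup public using (assoc; identityˡ; identityʳ; inverseˡ)
  open GroupProperties group public
    using ( ∙-cancelˡ; ∙-cancelʳ; inverseˡ-unique; identityˡ-unique; identityʳ-unique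
          ; ε⁻¹≈ε; ⁻¹-involutive; ⁻¹-anti-homo-∙
          ; \\-leftDividesˡ; \\-leftDividesʳ; //-rightDividesʳ )

  involution-selfInverse : ∀ {r} → r ∙ r ≡ ε → r ⁻¹ ≡ r
  involution-selfInverse {r} rr = sym (inverseˡ-unique r r rr)

  involution-unique : ∀ {r s} → s ∙ s ≡ ε → r ∙ s ≡ ε → r ≡ s
  involution-unique ss rs = trans (inverseˡ-unique _ _ rs) (involution-selfInverse ss)

  ∙-involutive : ∀ {r} → r ∙ r ≡ ε → ∀ x → x ∙ r ∙ r ≡ x
  ∙-involutive {r} rr x =
    trans (cong (x ∙ r ∙_) (sym (involution-selfInverse rr))) (//-rightDividesʳ r x)

  ∙-actions-commute : ∀ {a b} → a ∙ b ≡ b ∙ a → ∀ x → x ∙ b ∙ a ≡ x ∙ a ∙ b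
  ∙-actions-commute {a} {b} ab≡ba x =
    trans (assoc x b a) (trans (cong (x ∙_) (sym ab≡ba)) (sym (assoc x a b)))

  ∙≡∙⇒⁻¹∙≡∙⁻¹ : ∀ {a b c d} → a ∙ b ≡ c ∙ d → a ⁻¹ ∙ c ≡ b ∙ d ⁻¹
  ∙≡∙⇒⁻¹∙≡∙⁻¹ {a} {b} {c} {d} ab≡cd = begin
    a ⁻¹ ∙ c                ≡⟨ cong (a ⁻¹ ∙_) (sym (//-rightDividesʳ d c)) ⟩
    a ⁻¹ ∙ (c ∙ d ∙ d ⁻¹)   ≡⟨ cong (λ t → a ⁻¹ ∙ (t ∙ d ⁻¹)) (sym ab≡cd) ⟩
    a ⁻¹ ∙ (a ∙ b ∙ d ⁻¹)   ≡⟨ cong (a ⁻¹ ∙_) (assoc a b (d ⁻¹)) ⟩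
    a ⁻¹ ∙ (a ∙ (b ∙ d ⁻¹)) ≡⟨ \\-leftDividesʳ a (b ∙ d ⁻¹) ⟩
    b ∙ d ⁻¹                ∎
    where open ≡-Reasoning

  conjugate-⁻¹∙ : ∀ {r} → r ∙ r ≡ ε → ∀ x y → (x ∙ r) ⁻¹ ∙ (y ∙ r) ≡ r ∙ (x ⁻¹ ∙ y) ∙ r
  conjugate-⁻¹∙ {r} rr x y = begin
    (x ∙ r) ⁻¹ ∙ (y ∙ r)     ≡⟨ cong (_∙ (y ∙ r)) (⁻¹-anti-homo-∙ x r) ⟩
    r ⁻¹ ∙ x ⁻¹ ∙ (y ∙ r)    ≡⟨ cong (λ t → t ∙ x ⁻¹ ∙ (y ∙ r)) (involution-selfInverse rr) ⟩
    r ∙ x ⁻¹ ∙ (y ∙ r)       ≡⟨ sym (assoc (r ∙ x ⁻¹) y r) ⟩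
    r ∙ x ⁻¹ ∙ y ∙ r         ≡⟨ cong (_∙ r) (assoc r (x ⁻¹) y) ⟩
    r ∙ (x ⁻¹ ∙ y) ∙ r       ∎
    where open ≡-Reasoning

  ⟨⟩-∙ : ∀ {S x y} → ⟨ S ⟩ x → ⟨ S ⟩ y → ⟨ S ⟩ (x ∙ y)
  ⟨⟩-∙ {y = y} gen-ε hy = subst ⟨ _ ⟩ (sym (identityˡ y)) hy
  ⟨⟩-∙ {y = y} (gen-mul {s} {x} s∈S hx) hy =
    subst ⟨ _ ⟩ (sym (assoc s x y)) (gen-mul s∈S (⟨⟩-∙ hx hy))
  ⟨⟩-∙ {y = y} (gen-inv {s} {x} s∈S hx) hy =
    subst ⟨ _ ⟩ (sym (assoc (s ⁻¹) x y)) (gen-inv s∈S (⟨⟩-∙ hx hy))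

  ⟨⟩-generator : ∀ {S s} → s ∈ S → ⟨ S ⟩ s
  ⟨⟩-generator {s = s} s∈S = subst ⟨ _ ⟩ (identityʳ s) (gen-mul s∈S gen-ε)

  ⟨⟩-generator⁻¹ : ∀ {S s} → s ∈ S → ⟨ S ⟩ (s ⁻¹)
  ⟨⟩-generator⁻¹ {s = s} s∈S = subst ⟨ _ ⟩ (identityʳ (s ⁻¹)) (gen-inv s∈S gen-ε)

  ⟨⟩-⁻¹ : ∀ {S x} → ⟨ S ⟩ x → ⟨ S ⟩ (x ⁻¹)
  ⟨⟩-⁻¹ gen-ε = subst ⟨ _ ⟩ (sym ε⁻¹≈ε) gen-ε
  ⟨⟩-⁻¹ (gen-mul {s} {x} s∈S hx) =
    subst ⟨ _ ⟩ (sym (⁻¹-anti-homo-∙ s x)) (⟨⟩-∙ (⟨⟩-⁻¹ hx) (⟨⟩-generator⁻¹ s∈S))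
  ⟨⟩-⁻¹ (gen-inv {s} {x} s∈S hx) =
    subst ⟨ _ ⟩ (sym (trans (⁻¹-anti-homo-∙ (s ⁻¹) x) (cong (x ⁻¹ ∙_) (⁻¹-involutive s))))
      (⟨⟩-∙ (⟨⟩-⁻¹ hx) (⟨⟩-generator s∈S))

  ⟨⟩-cancelˡ : ∀ {S x y} → ⟨ S ⟩ x → ⟨ S ⟩ (x ∙ y) → ⟨ S ⟩ y
  ⟨⟩-cancelˡ {x = x} {y} hx hxy = subst ⟨ _ ⟩ (\\-leftDividesʳ x y) (⟨⟩-∙ (⟨⟩-⁻¹ hx) hxy)

  ⟨⟩-cancelʳ : ∀ {S x y} → ⟨ S ⟩ y → ⟨ S ⟩ (x ∙ y) → ⟨ S ⟩ x
  ⟨⟩-cancelʳ {x = x} {y} hy hxy = subst ⟨ _ ⟩ (//-rightDividesʳ y x) (⟨⟩-∙ hxy (⟨⟩-⁻¹ hy))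

  ⟨⟩-mono : ∀ {S T x} → S ⊆ T → ⟨ S ⟩ x → ⟨ T ⟩ x
  ⟨⟩-mono S⊆T gen-ε = gen-ε
  ⟨⟩-mono S⊆T (gen-mul s∈S h) = gen-mul (S⊆T s∈S) (⟨⟩-mono S⊆T h)
  ⟨⟩-mono S⊆T (gen-inv s∈S h) = gen-inv (S⊆T s∈S) (⟨⟩-mono S⊆T h)

  ⟨involution⟩-elements : ∀ {r x} → r ∙ r ≡ ε → ⟨ r ∷ [] ⟩ x → x ≡ ε ⊎ x ≡ r
  ⟨involution⟩-elements rr gen-ε = inj₁ refl
  ⟨involution⟩-elements rr (gen-mul (here refl) h) with ⟨involution⟩-elements rr h
  ... | inj₁ refl = inj₂ (identityʳ _)
  ... | inj₂ refl = inj₁ rr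
  ⟨involution⟩-elements rr (gen-inv (here refl) h) rewrite involution-selfInverse rr with ⟨involution⟩-elements rr h
  ... | inj₁ refl = inj₂ (identityʳ _)
  ... | inj₂ refl = inj₁ rr
  ⟨involution⟩-elements rr (gen-mul (there ()) h)
  ⟨involution⟩-elements rr (gen-inv (there ()) h)

  rightAction : Carrier → Carrier → Carrier
  rightAction s x = x ∙ s

  rightActions : List Carrier → List (Carrier → Carrier)
  rightActions = map rightAction

  sameOrbit⇒⟨⟩ : ∀ {S x y} → SameOrbit (rightActions S) x y → ⟨ S ⟩ (x ⁻¹ ∙ y)
  sameOrbit⇒⟨⟩ {x = x} orb-refl = subst ⟨ _ ⟩ (sym (inverseˡ x)) gen-ε
  sameOrbit⇒⟨⟩ {S} {x} {y} (orb-step f∈ o) with ∈-map⁻ rightAction f∈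
  ... | s , s∈S , refl = subst ⟨ S ⟩ s∙[xs]⁻¹y≡x⁻¹y (gen-mul s∈S (sameOrbit⇒⟨⟩ o))
    where
    open ≡-Reasoning
    s∙[xs]⁻¹y≡x⁻¹y : s ∙ ((x ∙ s) ⁻¹ ∙ y) ≡ x ⁻¹ ∙ y
    s∙[xs]⁻¹y≡x⁻¹y = begin
      s ∙ ((x ∙ s) ⁻¹ ∙ y)     ≡⟨ cong (λ t → s ∙ (t ∙ y)) (⁻¹-anti-homo-∙ x s) ⟩
      s ∙ (s ⁻¹ ∙ x ⁻¹ ∙ y)    ≡⟨ cong (s ∙_) (assoc (s ⁻¹) (x ⁻¹) y) ⟩
      s ∙ (s ⁻¹ ∙ (x ⁻¹ ∙ y))  ≡⟨ \\-leftDividesˡ s (x ⁻¹ ∙ y) ⟩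
      x ⁻¹ ∙ y                 ∎

  sameOrbit-∙ : ∀ {S} → All (λ s → s ∙ s ≡ ε) S →
                ∀ x {g} → ⟨ S ⟩ g → SameOrbit (rightActions S) x (x ∙ g)
  sameOrbit-∙ invs x gen-ε = subst (SameOrbit _ x) (sym (identityʳ x)) orb-refl
  sameOrbit-∙ invs x (gen-mul {s} {g} s∈S h) =
    orb-step (∈-map⁺ rightAction s∈S)
      (subst (SameOrbit _ (x ∙ s)) (assoc x s g) (sameOrbit-∙ invs (x ∙ s) h))
  sameOrbit-∙ invs x (gen-inv {s} {g} s∈S h) =
    orb-step (∈-map⁺ rightAction s∈S)
      (subst (SameOrbit _ (x ∙ s)) x∙s∙g≡x∙s⁻¹g (sameOrbit-∙ invs (x ∙ s) h))
    where
    x∙s∙g≡x∙s⁻¹g : x ∙ s ∙ g ≡ x ∙ (s ⁻¹ ∙ g)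
    x∙s∙g≡x∙s⁻¹g = trans (assoc x s g)
      (cong (λ t → x ∙ (t ∙ g)) (sym (involution-selfInverse (All.lookup invs s∈S))))

  ⟨⟩⇒sameOrbit : ∀ {S} → All (λ s → s ∙ s ≡ ε) S →
                 ∀ {x y} → ⟨ S ⟩ (x ⁻¹ ∙ y) → SameOrbit (rightActions S) x y
  ⟨⟩⇒sameOrbit invs {x} {y} h = subst (SameOrbit _ x) (\\-leftDividesˡ x y) (sameOrbit-∙ invs x h)

  index*size≤order : ∀ {S k m} {xs : Vec Carrier m} →
    NumCosets ⟨ S ⟩ k → Unique xs → VecAll.All ⟨ S ⟩ xs → k * m ≤ order
  index*size≤order {S} {k} {m} {xs} (rep , rep-distinct , _) xs-unique xs⊆S =
    injective⇒≤ {f = translate ∘ remQuot m}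
      (Injection.injective (↔⇒↣ (*↔× {k} {m})) ∘ translate-injective)
    where
    translate : Fin k × Fin m → Carrier
    translate (i , j) = rep i ∙ Vec.lookup xs j

    translate-injective : ∀ {p q} → translate p ≡ translate q → p ≡ q
    translate-injective {i , j} {i′ , j′} eq with i ≟ᶠ i′
    ... | yes refl = cong (i ,_) (lookup-injective xs-unique j j′ (∙-cancelˡ (rep i) _ _ eq))
    ... | no i≢i′ = ⊥-elim (rep-distinct i i′ i≢i′
          (subst ⟨ S ⟩ (sym (∙≡∙⇒⁻¹∙≡∙⁻¹ eq)) (⟨⟩-∙ (lookup⁺ xs⊆S j) (⟨⟩-⁻¹ (lookup⁺ xs⊆S j′)))))

  dihedralSix : Carrier → Carrier → Vec Carrier 6
  dihedralSix r s = ε ∷ r ∷ s ∷ r ∙ s ∷ s ∙ r ∷ r ∙ s ∙ r ∷ []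

  dihedralSix-unique : ∀ {r s} → IsInvolution r → IsInvolution s → r ≢ s → r ∙ s ≢ s ∙ r →
                       Unique (dihedralSix r s)
  dihedralSix-unique {r} {s} (r≢ε , rr) (s≢ε , ss) r≢s rs≢sr =
      (ε≢r ∷ ε≢s ∷ ε≢rs ∷ ε≢sr ∷ ε≢rsr ∷ [])
    ∷ (r≢s ∷ r≢rs ∷ r≢sr ∷ r≢rsr ∷ [])
    ∷ (s≢rs ∷ s≢sr ∷ s≢rsr ∷ [])
    ∷ (rs≢sr ∷ rs≢rsr ∷ [])
    ∷ (sr≢rsr ∷ [])
    ∷ [] ∷ []
    where
    ε≢r : ε ≢ r
    ε≢r = r≢ε ∘ sym
    ε≢s : ε ≢ s
    ε≢s = s≢ε ∘ sym
    ε≢rs : ε ≢ r ∙ s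
    ε≢rs e = r≢s (involution-unique ss (sym e))
    ε≢sr : ε ≢ s ∙ r
    ε≢sr e = r≢s (sym (involution-unique rr (sym e)))
    ε≢rsr : ε ≢ r ∙ s ∙ r
    ε≢rsr e = s≢ε (identityʳ-unique r s (involution-unique rr (sym e)))
    r≢rs : r ≢ r ∙ s
    r≢rs e = s≢ε (identityʳ-unique r s (sym e))
    r≢sr : r ≢ s ∙ r
    r≢sr e = s≢ε (identityˡ-unique s r (sym e))
    r≢rsr : r ≢ r ∙ s ∙ r
    r≢rsr e = r≢s (involution-unique ss (∙-cancelʳ r (r ∙ s) ε (trans (sym e) (sym (identityˡ r)))))
    s≢rs : s ≢ r ∙ s
    s≢rs e = r≢ε (identityˡ-unique r s (sym e))
    s≢sr : s ≢ s ∙ r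
    s≢sr e = r≢ε (identityʳ-unique s r (sym e))
    s≢rsr : s ≢ r ∙ s ∙ r
    s≢rsr e = rs≢sr (sym (trans (cong (_∙ r) e) (∙-involutive rr (r ∙ s))))
    rs≢rsr : r ∙ s ≢ r ∙ s ∙ r
    rs≢rsr e = r≢ε (identityʳ-unique (r ∙ s) r (sym e))
    sr≢rsr : s ∙ r ≢ r ∙ s ∙ r
    sr≢rsr e = r≢ε (identityˡ-unique r s (sym (∙-cancelʳ r s (r ∙ s) e)))

  dihedralSix⊆⟨⟩ : ∀ {S r s} → ⟨ S ⟩ r → ⟨ S ⟩ s → VecAll.All ⟨ S ⟩ (dihedralSix r s)
  dihedralSix⊆⟨⟩ hr hs =
    gen-ε ∷ hr ∷ hs ∷ ⟨⟩-∙ hr hs ∷ ⟨⟩-∙ hs hr ∷ ⟨⟩-∙ (⟨⟩-∙ hr hs) hr ∷ []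

  nonAbelianDihedral-index*6≤order : ∀ {r s k} → IsInvolution r → IsInvolution s → r ≢ s →
    r ∙ s ≢ s ∙ r → NumCosets ⟨ r ∷ s ∷ [] ⟩ k → k * 6 ≤ order
  nonAbelianDihedral-index*6≤order invr invs r≢s rs≢sr cosets =
    index*size≤order cosets (dihedralSix-unique invr invs r≢s rs≢sr)
      (dihedralSix⊆⟨⟩ (⟨⟩-generator (here refl)) (⟨⟩-generator (there (here refl))))

sixths-sum-too-small : ∀ {n V E F} → V * 6 ≤ n → E * 6 ≤ n → F * 6 ≤ n → 2 * (V + E + F) ≢ n + 4
sixths-sum-too-small {n} {V} {E} {F} V≤ E≤ F≤ euler = m+1+n≰m (3 * n) (begin
  3 * n + 12                  ≡⟨ 3*[n+4] n ⟩
  3 * (n + 4)                 ≡⟨ cong (3 *_) (sym euler) ⟩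
  3 * (2 * (V + E + F))       ≡⟨ 3*[2*[V+E+F]] V E F ⟩
  V * 6 + E * 6 + F * 6       ≤⟨ +-mono-≤ (+-mono-≤ V≤ E≤) F≤ ⟩
  n + n + n                   ≡⟨ n+n+n n ⟩
  3 * n                       ∎)
  where
  open ≤-Reasoning
  3*[n+4] : ∀ n → 3 * n + 12 ≡ 3 * (n + 4)
  3*[n+4] = solve-∀
  3*[2*[V+E+F]] : ∀ V E F → 3 * (2 * (V + E + F)) ≡ V * 6 + E * 6 + F * 6
  3*[2*[V+E+F]] = solve-∀
  n+n+n : ∀ n → n + n + n ≡ 3 * n
  n+n+n = solve-∀

≅-refl : (H : FlagSystem) → H ≅ H
≅-refl H = ↔-id _ , (λ _ → refl) , (λ _ → refl) , (λ _ → refl)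

swap01 : RegularLinearHypermap → RegularLinearHypermap
swap01 M = record
  { G = G ; r0 = r1 ; r1 = r0 ; r2 = r2
  ; inv0 = inv1 ; inv1 = inv0 ; inv2 = inv2
  ; r0≢r1 = r0≢r1 ∘ sym ; r0≢r2 = r1≢r2 ; r1≢r2 = r0≢r2
  ; generates = ⟨⟩-mono swap-generators ∘ generates
  ; linear₁ = λ x → proj₁ (linear₁ x) ∘ Product.swap , Product.swap ∘ proj₂ (linear₁ x)
  ; linear₂ = λ x → Sum.swap ∘ proj₁ (linear₂ x) ∘ Product.swap
                  , Product.swap ∘ proj₂ (linear₂ x) ∘ Sum.swap
  }
  where
  open RegularLinearHypermap M
  open FinGroupProperties G using (⟨⟩-mono)

  swap-generators : (r0 ∷ r1 ∷ r2 ∷ []) ⊆ (r1 ∷ r0 ∷ r2 ∷ [])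
  swap-generators (here p) = there (here p)
  swap-generators (there (here p)) = here p
  swap-generators (there (there p)) = there (there p)

module LinearHypermap (M : RegularLinearHypermap) where
  open RegularLinearHypermap M
  open FinGroupProperties G

  H₁₂ H₀₂ : Carrier → Set
  H₁₂ = ⟨ r1 ∷ r2 ∷ [] ⟩
  H₀₂ = ⟨ r0 ∷ r2 ∷ [] ⟩

  r0∉H₁₂ : ¬ H₁₂ r0
  r0∉H₁₂ r0∈H₁₂ = Sum.[ proj₁ inv0 , r0≢r2 ]′
    (⟨involution⟩-elements (proj₂ inv2) (proj₁ (linear₁ r0) (r0∈H₁₂ , ⟨⟩-generator (here refl))))

  -- r0 a = (r0 a r0) r0 ∈ H₁₂H₀₂ and r0 a ∈ H₀₂H₁₂, so by linearity (2) it lies in H₁₂ or H₀₂.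
  H₁₂-conjugate⇒H₀₂ : ∀ {a} → H₁₂ a → H₁₂ (r0 ∙ a ∙ r0) → H₀₂ a
  H₁₂-conjugate⇒H₀₂ {a} a∈H₁₂ conj∈H₁₂ =
    Sum.[ (λ r0a∈H₁₂ → ⊥-elim (r0∉H₁₂ (⟨⟩-cancelʳ a∈H₁₂ r0a∈H₁₂)))
        , ⟨⟩-cancelˡ r0∈H₀₂ ]′
      (proj₁ (linear₂ (r0 ∙ a)) (r0a∈H₁₂H₀₂ , r0a∈H₀₂H₁₂))
    where
    r0∈H₀₂ : H₀₂ r0
    r0∈H₀₂ = ⟨⟩-generator (here refl)
    r0a∈H₁₂H₀₂ : (H₁₂ ·ₛ H₀₂) (r0 ∙ a)
    r0a∈H₁₂H₀₂ = r0 ∙ a ∙ r0 , r0 , conj∈H₁₂ , r0∈H₀₂ , sym (∙-involutive (proj₂ inv0) (r0 ∙ a))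
    r0a∈H₀₂H₁₂ : (H₀₂ ·ₛ H₁₂) (r0 ∙ a)
    r0a∈H₀₂H₁₂ = r0 , a , r0∈H₀₂ , a∈H₁₂ , refl

  digonBaseMap : r0 ∙ r2 ≡ r2 ∙ r0 → MapWithSimpleGraph
  digonBaseMap r0r2≡r2r0 = record
    { size = order
    ; τ0 = _∙ r0 ; τ1 = _∙ r1 ; τ2 = _∙ r2
    ; τ0-invol = ∙-involutive rr0
    ; τ1-invol = ∙-involutive rr1
    ; τ2-invol = ∙-involutive rr2
    ; τ0-fpf = λ x → proj₁ inv0 ∘ identityʳ-unique x r0
    ; τ1-fpf = λ x → proj₁ inv1 ∘ identityʳ-unique x r1
    ; τ2-fpf = λ x → proj₁ inv2 ∘ identityʳ-unique x r2
    ; τ02-comm = ∙-actions-commute r0r2≡r2r0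
    ; τ02-fpf = λ x x∙r2∙r0≡x → r0≢r2 (sym (involution-unique rr0
                 (identityʳ-unique x (r2 ∙ r0) (trans (sym (assoc x r2 r0)) x∙r2∙r0≡x))))
    ; connected = λ x y → ⟨⟩⇒sameOrbit (rr0 ∷ rr1 ∷ rr2 ∷ []) (generates _)
    ; noLoops = λ x → r0∉H₁₂ ∘ subst H₁₂ (\\-leftDividesʳ x r0) ∘ sameOrbit⇒⟨⟩ {S = r1 ∷ r2 ∷ []}
    ; noMultiEdges = λ x y sameVertex sameVertex′ → ⟨⟩⇒sameOrbit (rr0 ∷ rr2 ∷ [])
        (H₁₂-conjugate⇒H₀₂ (sameOrbit⇒⟨⟩ {S = r1 ∷ r2 ∷ []} sameVertex)
          (subst H₁₂ (conjugate-⁻¹∙ rr0 x y) (sameOrbit⇒⟨⟩ {S = r1 ∷ r2 ∷ []} sameVertex′)))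
    }
    where
    rr0 : r0 ∙ r0 ≡ ε
    rr0 = proj₂ inv0
    rr1 : r1 ∙ r1 ≡ ε
    rr1 = proj₂ inv1
    rr2 : r2 ∙ r2 ≡ ε
    rr2 = proj₂ inv2

  isDigon : r0 ∙ r2 ≡ r2 ∙ r0 → IsDigon (flagsOf M)
  isDigon r0r2≡r2r0 = digonBaseMap r0r2≡r2r0 , ≅-refl (flagsOf M)

open LinearHypermap using (isDigon)

module _ (M : RegularLinearHypermap) where
  open RegularLinearHypermap M
  open FinGroupProperties G
  open LinearHypermap M using (H₁₂; H₁₂-conjugate⇒H₀₂)
  open LinearHypermap (swap01 M) using () renaming (r0∉H₁₂ to r1∉H₀₂)

  isMedial : r1 ∙ r2 ≡ r2 ∙ r1 → IsMedial (flagsOf M)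
  isMedial r1r2≡r2r1 = LinearHypermap.digonBaseMap (swap01 M) r1r2≡r2r1 , ≅-refl (flagsOf M)

  r0r1≢r1r0 : r0 ∙ r1 ≢ r1 ∙ r0
  r0r1≢r1r0 r0r1≡r1r0 = r1∉H₀₂ (H₁₂-conjugate⇒H₀₂ r1∈H₁₂ (subst H₁₂ (sym r0r1r0≡r1) r1∈H₁₂))
    where
    r1∈H₁₂ : H₁₂ r1
    r1∈H₁₂ = ⟨⟩-generator (here refl)
    r0r1r0≡r1 : r0 ∙ r1 ∙ r0 ≡ r1
    r0r1r0≡r1 = trans (cong (_∙ r0) r0r1≡r1r0) (∙-involutive (proj₂ inv0) r1)

  onSphere⇒commuting : OnSphere M → r1 ∙ r2 ≡ r2 ∙ r1 ⊎ r0 ∙ r2 ≡ r2 ∙ r0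
  onSphere⇒commuting (_ , V , E , F , cosetsV , cosetsE , cosetsF , euler)
    with r1 ∙ r2 ≟ᶠ r2 ∙ r1 | r0 ∙ r2 ≟ᶠ r2 ∙ r0
  ... | yes r1r2≡r2r1 | _ = inj₁ r1r2≡r2r1
  ... | no _ | yes r0r2≡r2r0 = inj₂ r0r2≡r2r0
  ... | no r1r2≢r2r1 | no r0r2≢r2r0 = ⊥-elim (sixths-sum-too-small {order} {V} {E} {F}
          (nonAbelianDihedral-index*6≤order inv1 inv2 r1≢r2 r1r2≢r2r1 cosetsV)
          (nonAbelianDihedral-index*6≤order inv0 inv2 r0≢r2 r0r2≢r2r0 cosetsE)
          (nonAbelianDihedral-index*6≤order inv0 inv1 r0≢r1 r0r1≢r1r0 cosetsF)
          euler)

corollary4p11 : (M : RegularLinearHypermap) → OnSphere M →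
    IsMedial (flagsOf M) ⊎ IsDigon (flagsOf M)
corollary4p11 M = Sum.map (isMedial M) (isDigon M) ∘ onSphere⇒commuting M
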